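{- Let $\pi$ be a permutation of $\{1,\dots,n\}$ that avoids both $213$ and $231$, and let $1\le i<n$. Then (1) $\pi[i]$ is an ascent element if and only if $\pi[i]$ is a LRMin, and (2) $\pi[i]$ is a descent element if and only if $\pi[i]$ is a LRMax.
   Context: A permutation $\pi$ of length $n$ is written as a word $\pi[1]\cdots\pi[n]$, and $\pi[i:]$ denotes $\pi[i]\cdots\pi[n]$. A permutation avoids $\tau$ if it has no subsequence with the same relative order as $\tau$. For $1\le i<n$, $\pi[i]$ is an ascent element if $\pi[i]<\pi[i+1]$ and a descent element if $\pi[i]>\pi[i+1]$. Following the paper's terminology, $\pi[i]$ is a LRMax if it is the largest element of $\pi[i:]$, and a LRMin if it is the smallest element of $\pi[i:]$. -}

module Defs where

open import Data.Nat using (ℕ)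
open import Data.Fin using (Fin; _<_; _≤_)
open import Data.Product using (∃-syntax; _×_)
open import Relation.Nullary using (¬_)
open import Function.Definitions using (Injective)
open import Relation.Binary.PropositionalEquality using (_≡_)

-- A permutation of length n: a bijection of Fin n (positions 0..n-1 to
-- values 0..n-1).  On a finite set injective = bijective.
Perm : ℕ → Set
Perm n = Fin n → Fin n

IsPerm : ∀ {n} → Perm n → Set
IsPerm π = Injective _≡_ _≡_ π

Contains213 : ∀ {n} → Perm n → Set
Contains213 {n} π = ∃[ a ] ∃[ b ] ∃[ c ]
  (a < b × b < c × π b < π a × π a < π c)

Contains231 : ∀ {n} → Perm n → Set
Contains231 {n} π = ∃[ a ] ∃[ b ] ∃[ c ]
  (a < b × b < c × π c < π a × π a < π b)

Avoids213 : ∀ {n} → Perm n → Set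
Avoids213 π = ¬ Contains213 π

Avoids231 : ∀ {n} → Perm n → Set
Avoids231 π = ¬ Contains231 π

IsLRMax : ∀ {n} → Perm n → Fin n → Set
IsLRMax π i = ∀ j → i ≤ j → π j ≤ π i

IsLRMin : ∀ {n} → Perm n → Fin n → Set
IsLRMin π i = ∀ j → i ≤ j → π i ≤ π j

-- Avoiding 213 and 231 means that no value π p lies strictly between two
-- later values.  So if some later value exceeds π p, every later value does
-- (π p is a LRMin), and if some later value is below π p, every later value
-- is (π p is a LRMax).  Applied to the neighbour π (p + 1) this gives both
-- directions of each equivalence; injectivity excludes π p = π (p + 1).
module Submission where

open import Defs
open import Data.Nat using (ℕ; suc)
open import Data.Fin using (Fin; inject₁; _<_; _>_; _≤_; _≤?_)
import Data.Fin as F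
open import Data.Fin.Properties using (<-cmp; <-asym; <-irrefl; <⇒≢; ≤-refl; ≤∧≢⇒<; ≤̄⇒inject₁<)
import Data.Nat.Properties as ℕ
open import Data.Product using (_×_; _,_)
open import Data.Empty using (⊥; ⊥-elim)
open import Function.Bundles using (_⇔_; mk⇔)
open import Relation.Binary.Definitions using (tri<; tri≈; tri>)
open import Relation.Binary.PropositionalEquality using (_≢_; refl; sym; ≢-sym)
open import Relation.Nullary using (yes; no)

module _ {n : ℕ} {π : Perm n} (avoids213 : Avoids213 π) (avoids231 : Avoids231 π) where

  no-value-between-later-values : ∀ {p j k} → p < j → p < k → π j < π p → π p < π k → ⊥
  no-value-between-later-values {p} {j} {k} p<j p<k πj<πp πp<πk with <-cmp j k
  ... | tri< j<k _ _ = avoids213 (p , j , k , p<j , j<k , πj<πp , πp<πk)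
  ... | tri≈ _ refl _ = <-asym πj<πp πp<πk
  ... | tri> _ _ k<j = avoids231 (p , k , j , p<k , k<j , πj<πp , πp<πk)

  ≤∧distinct-values⇒< : ∀ {p j} → p ≤ j → π p ≢ π j → p < j
  ≤∧distinct-values⇒< p≤j πp≢πj = ≤∧≢⇒< p≤j (λ { refl → πp≢πj refl })

  larger-later⇒IsLRMin : ∀ {p q} → p < q → π p < π q → IsLRMin π p
  larger-later⇒IsLRMin {p} p<q πp<πq j p≤j with π p ≤? π j
  ... | yes πp≤πj = πp≤πj
  ... | no πp≰πj = ⊥-elim
    (no-value-between-later-values (≤∧distinct-values⇒< p≤j (≢-sym (<⇒≢ πj<πp))) p<q πj<πp πp<πq)
    where
    πj<πp : π j < π p
    πj<πp = ℕ.≰⇒> πp≰πj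

  smaller-later⇒IsLRMax : ∀ {p q} → p < q → π q < π p → IsLRMax π p
  smaller-later⇒IsLRMax {p} p<q πq<πp j p≤j with π j ≤? π p
  ... | yes πj≤πp = πj≤πp
  ... | no πj≰πp = ⊥-elim
    (no-value-between-later-values p<q (≤∧distinct-values⇒< p≤j (<⇒≢ πp<πj)) πq<πp πp<πj)
    where
    πp<πj : π p < π j
    πp<πj = ℕ.≰⇒> πj≰πp

module _ {n : ℕ} {π : Perm n} (injective : IsPerm π) {p q : Fin n} (p<q : p < q) where

  IsLRMin⇒<-later : IsLRMin π p → π p < π q
  IsLRMin⇒<-later lrMin = ≤∧≢⇒< (lrMin q (ℕ.<⇒≤ p<q)) (λ e → <-irrefl (injective e) p<q)

  IsLRMax⇒>-later : IsLRMax π p → π q < π p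
  IsLRMax⇒>-later lrMax = ≤∧≢⇒< (lrMax q (ℕ.<⇒≤ p<q)) (λ e → <-irrefl (injective (sym e)) p<q)

corollary2 : (m : ℕ) (π : Perm (suc m)) → IsPerm π →
    Avoids213 π → Avoids231 π → (i : Fin m) →
      ((π (inject₁ i) < π (F.suc i)) ⇔ IsLRMin π (inject₁ i))
      × ((π (inject₁ i) > π (F.suc i)) ⇔ IsLRMax π (inject₁ i))
corollary2 m π injective avoids213 avoids231 i =
    mk⇔ (larger-later⇒IsLRMin avoids213 avoids231 i<i+1) (IsLRMin⇒<-later injective i<i+1)
  , mk⇔ (smaller-later⇒IsLRMax avoids213 avoids231 i<i+1) (IsLRMax⇒>-later injective i<i+1)
  where
  i<i+1 : inject₁ i < F.suc i
  i<i+1 = ≤̄⇒inject₁< ≤-refl
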